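{- For any $\beta\in(0,1]$, the probability vector $p$ of the $(1+\beta)$-process, given by $p_i=(1-\beta)\cdot\frac1n+\beta\cdot\frac{2i-1}{n^2}$ for $i\in[n]$, satisfies condition $\mathcal{C}_1$ with $\delta=\frac14$ and $\epsilon=\frac\beta2$, condition $\mathcal{C}_2$ with $C=1+\beta$, and condition $\mathcal{C}_3$ with $C=1+\beta$.
   Context: For a probability vector $p\in\mathbb{R}^n$: Condition $\mathcal{C}_1$ (quantile $\delta\in(0,1)$, $\epsilon\in(0,1)$): for all $1\le k\le\delta n$, $\sum_{i=1}^k p_i\le(1-\epsilon)\frac kn$, and for all $\delta n+1\le k\le n$, $\sum_{i=k}^n p_i\ge\left(1+\epsilon\frac{\delta}{1-\delta}\right)\frac{n-k+1}{n}$. Condition $\mathcal{C}_2$ (for $C>1$): $\max_{i\in[n]}p_i\le\frac Cn$. Condition $\mathcal{C}_3$ (for $C>1$): $\max_{i\in[n]}|p_i-\frac1n|\le\frac{C-1}{n}$.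
   Formalization: The parameter β ranges over the rationals in (0,1], so the probability vector p of the (1+β)-process has rational entries. -}

module Defs where

open import Data.Nat as ℕ using (ℕ; zero; suc; _∸_)
open import Data.Integer as ℤ using (+_)
open import Data.Rational
open import Data.Product using (_×_)
open import Data.Nat.Properties using (m*n≢0)

⟦_⟧ : ℕ → ℚ
⟦ m ⟧ = + m / 1

sumFromLen : (ℕ → ℚ) → ℕ → ℕ → ℚ
sumFromLen f k zero    = 0ℚ
sumFromLen f k (suc m) = f k + sumFromLen f (suc k) m

-- Σ_{i=a}^{b} f i  (empty if b < a)
Σ[_⋯_]_ : ℕ → ℕ → (ℕ → ℚ) → ℚ
Σ[ a ⋯ b ] f = sumFromLen f a (suc b ∸ a)

-- Probability vectors are 1-indexed functions p : ℕ → ℚ (only p 1, …, p n matter).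

C₁ : (n : ℕ) .{{_ : ℕ.NonZero n}} → (p : ℕ → ℚ) → (δ ε : ℚ) → .{{_ : NonZero (1ℚ - δ)}} → Set
C₁ n p δ ε =
  (∀ (k : ℕ) → 1 ℕ.≤ k → ⟦ k ⟧ ≤ δ * ⟦ n ⟧ →
      Σ[ 1 ⋯ k ] p ≤ (1ℚ - ε) * (+ k / n))
  × (∀ (k : ℕ) → δ * ⟦ n ⟧ + 1ℚ ≤ ⟦ k ⟧ → k ℕ.≤ n →
      (1ℚ + ε * (δ ÷ (1ℚ - δ))) * (+ (n ∸ k ℕ.+ 1) / n) ≤ Σ[ k ⋯ n ] p)

C₂ : (n : ℕ) .{{_ : ℕ.NonZero n}} → (p : ℕ → ℚ) → (C : ℚ) → Set
C₂ n p C = ∀ (i : ℕ) → 1 ℕ.≤ i → i ℕ.≤ n → p i ≤ C * (+ 1 / n)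

C₃ : (n : ℕ) .{{_ : ℕ.NonZero n}} → (p : ℕ → ℚ) → (C : ℚ) → Set
C₃ n p C = ∀ (i : ℕ) → 1 ℕ.≤ i → i ℕ.≤ n → ∣ p i - + 1 / n ∣ ≤ (C - 1ℚ) * (+ 1 / n)

oneBetaProcess : (β : ℚ) → (n : ℕ) .{{_ : ℕ.NonZero n}} → ℕ → ℚ
oneBetaProcess β n i = (1ℚ - β) * (+ 1 / n) + β * (+ (2 ℕ.* i ∸ 1) / (n ℕ.* n))
  where instance _ = m*n≢0 n n

module Submission where

-- Write u = 1/n. Then p_i = (1 - β) u + β u² (2i - 1) is affine in the odd numbers, and the odd
-- numbers 2i - 1 with a < i ≤ a + m add up to (a + m)² - a², so the m entries after the first a
-- have mass m u (1 - β + β (m + 2a) u). Hence a prefix of relative length x = k/n ≤ 1/4 has mass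
-- x (1 - β + β x) ≤ x (1 - β/2), and a suffix of relative length y = 1 - z with z ≥ 1/4 has mass
-- y (1 + β z) ≥ y (1 + β/6) = y (1 + ε δ/(1 - δ)). Finally p_i - u = β u ((2i - 1) u - 1) with
-- 0 ≤ (2i - 1) u ≤ 2 gives C₃, and C₃ with constant C implies C₂ with the same C for any vector.

open import Defs
open import Data.Nat as ℕ using (ℕ)
open import Data.Rational
open import Data.Integer using (+_)
open import Data.Product using (_×_)

open import Data.Nat using (zero; suc; _∸_)
import Data.Nat.Properties as ℕP
import Data.Integer as ℤ
import Data.Integer.Properties as ℤP
open import Data.Rational.Properties
import Data.Rational.Unnormalised as ℚᵘ
import Data.Rational.Unnormalised.Properties as ℚᵘP
open import Algebra.Properties.Group +-0-group using (⁻¹-involutive)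
open import Data.Product using (_,_)
open import Data.Sum using (inj₁; inj₂)
open import Data.Unit using (tt)
open import Relation.Binary.PropositionalEquality
open import Relation.Nullary using (contradiction)
open import Data.Rational.Solver
open +-*-Solver using (solve; _:+_; _:*_; _:-_; _:=_; con)

⟦⟧-homo-+ : ∀ a b → ⟦ a ℕ.+ b ⟧ ≡ ⟦ a ⟧ + ⟦ b ⟧
⟦⟧-homo-+ a b = toℚᵘ-injective (begin
  toℚᵘ ⟦ a ℕ.+ b ⟧                         ≈⟨ toℚᵘ-fromℚᵘ _ ⟩
  ℚᵘ.mkℚᵘ (+ (a ℕ.+ b)) 0                   ≡⟨ cong (λ z → ℚᵘ.mkℚᵘ z 0) numerator ⟩
  ℚᵘ.mkℚᵘ (+ a ℤ.* + 1 ℤ.+ + b ℤ.* + 1) 0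
    ≈⟨ ℚᵘP.+-cong (toℚᵘ-fromℚᵘ (ℚᵘ.mkℚᵘ (+ a) 0)) (toℚᵘ-fromℚᵘ (ℚᵘ.mkℚᵘ (+ b) 0)) ⟨
  toℚᵘ ⟦ a ⟧ ℚᵘ.+ toℚᵘ ⟦ b ⟧                ≈⟨ toℚᵘ-homo-+ ⟦ a ⟧ ⟦ b ⟧ ⟨
  toℚᵘ (⟦ a ⟧ + ⟦ b ⟧)                      ∎)
  where
  open ℚᵘP.≃-Reasoning
  numerator : + (a ℕ.+ b) ≡ + a ℤ.* + 1 ℤ.+ + b ℤ.* + 1
  numerator = trans (ℤP.pos-+ a b) (sym (cong₂ ℤ._+_ (ℤP.*-identityʳ (+ a)) (ℤP.*-identityʳ (+ b))))

a/d*b/e≡ab/de : ∀ a b d e .{{_ : ℕ.NonZero d}} .{{_ : ℕ.NonZero e}} →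
                (+ a / d) * (+ b / e) ≡ (+ (a ℕ.* b) / (d ℕ.* e)) {{ℕP.m*n≢0 d e}}
a/d*b/e≡ab/de a b (suc d) (suc e) = toℚᵘ-injective (begin
  toℚᵘ ((+ a / suc d) * (+ b / suc e))
    ≈⟨ toℚᵘ-homo-* (+ a / suc d) (+ b / suc e) ⟩
  toℚᵘ (+ a / suc d) ℚᵘ.* toℚᵘ (+ b / suc e)
    ≈⟨ ℚᵘP.*-cong (toℚᵘ-fromℚᵘ (ℚᵘ.mkℚᵘ (+ a) d)) (toℚᵘ-fromℚᵘ (ℚᵘ.mkℚᵘ (+ b) e)) ⟩
  ℚᵘ.mkℚᵘ (+ a ℤ.* + b) (ℕ.pred (suc d ℕ.* suc e))
    ≡⟨ cong (λ z → ℚᵘ.mkℚᵘ z _) (ℤP.pos-* a b) ⟨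
  ℚᵘ.mkℚᵘ (+ (a ℕ.* b)) (ℕ.pred (suc d ℕ.* suc e))
    ≈⟨ toℚᵘ-fromℚᵘ _ ⟨
  toℚᵘ (+ (a ℕ.* b) / (suc d ℕ.* suc e))
    ∎)
  where open ℚᵘP.≃-Reasoning

⟦⟧-homo-* : ∀ a b → ⟦ a ℕ.* b ⟧ ≡ ⟦ a ⟧ * ⟦ b ⟧
⟦⟧-homo-* a b = sym (a/d*b/e≡ab/de a b 1 1)

a/d≡⟦a⟧*1/d : ∀ a d .{{_ : ℕ.NonZero d}} → + a / d ≡ ⟦ a ⟧ * (+ 1 / d)
a/d≡⟦a⟧*1/d a d = sym (trans (a/d*b/e≡ab/de a 1 1 d)
  (/-cong {{ℕP.m*n≢0 1 d}} (cong +_ (ℕP.*-identityʳ a)) (ℕP.*-identityˡ d)))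

⟦n⟧*1/n≡1 : ∀ n .{{_ : ℕ.NonZero n}} → ⟦ n ⟧ * (+ 1 / n) ≡ 1ℚ
⟦n⟧*1/n≡1 n@(suc _) = trans (sym (a/d≡⟦a⟧*1/d n n)) (toℚᵘ-injective (begin
  toℚᵘ (+ n / n)   ≈⟨ toℚᵘ-fromℚᵘ _ ⟩
  ℚᵘ.mkℚᵘ (+ n) _  ≈⟨ ℚᵘ.*≡* (trans (ℤP.*-identityʳ (+ n)) (sym (ℤP.*-identityˡ (+ n)))) ⟩
  ℚᵘ.1ℚᵘ           ∎))
  where open ℚᵘP.≃-Reasoning

a/d²≡⟦a⟧*1/d*1/d : ∀ a d .{{_ : ℕ.NonZero d}} →
                   (+ a / (d ℕ.* d)) {{ℕP.m*n≢0 d d}} ≡ ⟦ a ⟧ * (+ 1 / d) * (+ 1 / d)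
a/d²≡⟦a⟧*1/d*1/d a d = begin
  (+ a / (d ℕ.* d)) {{ℕP.m*n≢0 d d}}
    ≡⟨ /-cong {{ℕP.m*n≢0 d d}} {{ℕP.m*n≢0 d d}} (cong +_ (ℕP.*-identityʳ a)) refl ⟨
  (+ (a ℕ.* 1) / (d ℕ.* d)) {{ℕP.m*n≢0 d d}} ≡⟨ a/d*b/e≡ab/de a 1 d d ⟨
  (+ a / d) * (+ 1 / d)                      ≡⟨ cong (_* (+ 1 / d)) (a/d≡⟦a⟧*1/d a d) ⟩
  ⟦ a ⟧ * (+ 1 / d) * (+ 1 / d)              ∎
  where open ≡-Reasoning

q*⟦n⟧*1/n≡q : ∀ q n .{{_ : ℕ.NonZero n}} → q * ⟦ n ⟧ * (+ 1 / n) ≡ q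
q*⟦n⟧*1/n≡q q n = trans (*-assoc q ⟦ n ⟧ (+ 1 / n)) (trans (cong (q *_) (⟦n⟧*1/n≡1 n)) (*-identityʳ q))

⟦⟧-nonNeg : ∀ a → NonNegative ⟦ a ⟧
⟦⟧-nonNeg a = normalize-nonNeg a 1

0≤⟦⟧ : ∀ a → 0ℚ ≤ ⟦ a ⟧
0≤⟦⟧ a = nonNegative⁻¹ ⟦ a ⟧ {{⟦⟧-nonNeg a}}

⟦⟧-mono-≤ : ∀ {a b} → a ℕ.≤ b → ⟦ a ⟧ ≤ ⟦ b ⟧
⟦⟧-mono-≤ {a} {b} a≤b = begin
  ⟦ a ⟧               ≡⟨ +-identityʳ _ ⟨
  ⟦ a ⟧ + 0ℚ          ≤⟨ +-monoʳ-≤ ⟦ a ⟧ (0≤⟦⟧ (b ∸ a)) ⟩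
  ⟦ a ⟧ + ⟦ b ∸ a ⟧   ≡⟨ ⟦⟧-homo-+ a (b ∸ a) ⟨
  ⟦ a ℕ.+ (b ∸ a) ⟧   ≡⟨ cong ⟦_⟧ (ℕP.m+[n∸m]≡n a≤b) ⟩
  ⟦ b ⟧               ∎
  where open ≤-Reasoning

p≤∣p∣ : ∀ p → p ≤ ∣ p ∣
p≤∣p∣ p with ≤-total 0ℚ p
... | inj₁ 0≤p = ≤-reflexive (sym (0≤p⇒∣p∣≡p 0≤p))
... | inj₂ p≤0 = ≤-trans p≤0 (0≤∣p∣ p)

-q≤p≤q⇒∣p∣≤q : ∀ {p q} → - q ≤ p → p ≤ q → ∣ p ∣ ≤ q
-q≤p≤q⇒∣p∣≤q {p} {q} -q≤p p≤q with ∣p∣≡p∨∣p∣≡-p p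
... | inj₁ ∣p∣≡p  = subst (_≤ q) (sym ∣p∣≡p) p≤q
... | inj₂ ∣p∣≡-p = subst₂ _≤_ (sym ∣p∣≡-p) (⁻¹-involutive q) (neg-antimono-≤ -q≤p)

sumFromLen-cong : ∀ {f g : ℕ → ℚ} → (∀ i → f i ≡ g i) → ∀ k m → sumFromLen f k m ≡ sumFromLen g k m
sumFromLen-cong f≗g k zero    = refl
sumFromLen-cong f≗g k (suc m) = cong₂ _+_ (f≗g k) (sumFromLen-cong f≗g (suc k) m)

⟦2[1+a]∸1⟧≡1+2⟦a⟧ : ∀ a → ⟦ 2 ℕ.* suc a ∸ 1 ⟧ ≡ 1ℚ + ⟦ 2 ⟧ * ⟦ a ⟧
⟦2[1+a]∸1⟧≡1+2⟦a⟧ a = begin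
  ⟦ 2 ℕ.* suc a ∸ 1 ⟧   ≡⟨ cong ⟦_⟧ (ℕP.+-suc a (a ℕ.+ 0)) ⟩
  ⟦ 1 ℕ.+ 2 ℕ.* a ⟧     ≡⟨ ⟦⟧-homo-+ 1 (2 ℕ.* a) ⟩
  1ℚ + ⟦ 2 ℕ.* a ⟧      ≡⟨ cong (λ t → 1ℚ + t) (⟦⟧-homo-* 2 a) ⟩
  1ℚ + ⟦ 2 ⟧ * ⟦ a ⟧    ∎
  where open ≡-Reasoning

sumFromLen-affine-odd : ∀ c d a m →
  sumFromLen (λ i → c + d * ⟦ 2 ℕ.* i ∸ 1 ⟧) (suc a) m ≡ ⟦ m ⟧ * (c + d * (⟦ m ⟧ + ⟦ 2 ⟧ * ⟦ a ⟧))
sumFromLen-affine-odd c d a zero    = sym (*-zeroˡ (c + d * (⟦ 0 ⟧ + ⟦ 2 ⟧ * ⟦ a ⟧)))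
sumFromLen-affine-odd c d a (suc m) = begin
  c + d * ⟦ 2 ℕ.* suc a ∸ 1 ⟧ + sumFromLen _ (suc (suc a)) m
    ≡⟨ cong₂ _+_ (cong (λ t → c + d * t) (⟦2[1+a]∸1⟧≡1+2⟦a⟧ a)) (sumFromLen-affine-odd c d (suc a) m) ⟩
  c + d * (1ℚ + ⟦ 2 ⟧ * X) + M * (c + d * (M + ⟦ 2 ⟧ * ⟦ suc a ⟧))
    ≡⟨ cong (λ t → c + d * (1ℚ + ⟦ 2 ⟧ * X) + M * (c + d * (M + ⟦ 2 ⟧ * t))) (⟦⟧-homo-+ 1 a) ⟩
  c + d * (1ℚ + ⟦ 2 ⟧ * X) + M * (c + d * (M + ⟦ 2 ⟧ * (1ℚ + X)))
    ≡⟨ solve 4 (λ c d X M →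
         c :+ d :* (con 1ℚ :+ con ⟦ 2 ⟧ :* X) :+ M :* (c :+ d :* (M :+ con ⟦ 2 ⟧ :* (con 1ℚ :+ X)))
         := (con 1ℚ :+ M) :* (c :+ d :* ((con 1ℚ :+ M) :+ con ⟦ 2 ⟧ :* X))) refl c d X M ⟩
  (1ℚ + M) * (c + d * ((1ℚ + M) + ⟦ 2 ⟧ * X))
    ≡⟨ cong (λ t → t * (c + d * (t + ⟦ 2 ⟧ * X))) (⟦⟧-homo-+ 1 m) ⟨
  ⟦ suc m ⟧ * (c + d * (⟦ suc m ⟧ + ⟦ 2 ⟧ * X)) ∎
  where
  open ≡-Reasoning
  X M : ℚ
  X = ⟦ a ⟧
  M = ⟦ m ⟧

+-cancelʳ-≤ : ∀ r {p q} → p + r ≤ q + r → p ≤ q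
+-cancelʳ-≤ r {p} {q} p+r≤q+r = begin
  p              ≡⟨ solve 2 (λ p r → p := p :+ r :- r) refl p r ⟩
  p + r - r      ≤⟨ +-monoˡ-≤ (- r) p+r≤q+r ⟩
  q + r - r      ≡⟨ solve 2 (λ q r → q :+ r :- r := q) refl q r ⟩
  q              ∎
  where open ≤-Reasoning

¼ : ℚ
¼ = + 1 / 4

C₃⇒C₂ : ∀ n .{{_ : ℕ.NonZero n}} (p : ℕ → ℚ) C → C₃ n p C → C₂ n p C
C₃⇒C₂ n p C c₃ i 1≤i i≤n = begin
  p i                              ≡⟨ solve 2 (λ x u → x := u :+ (x :- u)) refl (p i) u ⟩
  u + (p i - u)                    ≤⟨ +-monoʳ-≤ u (p≤∣p∣ (p i - u)) ⟩
  u + ∣ p i - u ∣                  ≤⟨ +-monoʳ-≤ u (c₃ i 1≤i i≤n) ⟩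
  u + (C - 1ℚ) * u                 ≡⟨ solve 2 (λ C u → u :+ (C :- con 1ℚ) :* u := C :* u) refl C u ⟩
  C * u                            ∎
  where
  open ≤-Reasoning
  u : ℚ
  u = + 1 / n

module _ (β : ℚ) (n : ℕ) .{{_ : ℕ.NonZero n}} where
  private
    u : ℚ
    u = + 1 / n
    N : ℚ
    N = ⟦ n ⟧
    p : ℕ → ℚ
    p = oneBetaProcess β n
    instance
      u-nonNeg : NonNegative u
      u-nonNeg = normalize-nonNeg 1 n

  oneBetaProcess-affine : ∀ i → p i ≡ (1ℚ - β) * u + β * u * u * ⟦ 2 ℕ.* i ∸ 1 ⟧
  oneBetaProcess-affine i = begin
    p i
      ≡⟨ cong (λ t → (1ℚ - β) * u + β * t) (a/d²≡⟦a⟧*1/d*1/d A n) ⟩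
    (1ℚ - β) * u + β * (⟦ A ⟧ * u * u)
      ≡⟨ solve 3 (λ β u A → (con 1ℚ :- β) :* u :+ β :* (A :* u :* u)
                          := (con 1ℚ :- β) :* u :+ β :* u :* u :* A) refl β u ⟦ A ⟧ ⟩
    (1ℚ - β) * u + β * u * u * ⟦ A ⟧
      ∎
    where
    open ≡-Reasoning
    A : ℕ
    A = 2 ℕ.* i ∸ 1

  oneBetaProcess-window : ∀ a m →
    sumFromLen p (suc a) m ≡ ⟦ m ⟧ * u * (1ℚ - β + β * (⟦ m ⟧ + ⟦ 2 ⟧ * ⟦ a ⟧) * u)
  oneBetaProcess-window a m = begin
    sumFromLen p (suc a) m
      ≡⟨ sumFromLen-cong oneBetaProcess-affine (suc a) m ⟩
    sumFromLen (λ i → (1ℚ - β) * u + β * u * u * ⟦ 2 ℕ.* i ∸ 1 ⟧) (suc a) m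
      ≡⟨ sumFromLen-affine-odd ((1ℚ - β) * u) (β * u * u) a m ⟩
    M * ((1ℚ - β) * u + β * u * u * (M + ⟦ 2 ⟧ * X))
      ≡⟨ solve 4 (λ β u M X → M :* ((con 1ℚ :- β) :* u :+ β :* u :* u :* (M :+ con ⟦ 2 ⟧ :* X))
                            := M :* u :* (con 1ℚ :- β :+ β :* (M :+ con ⟦ 2 ⟧ :* X) :* u)) refl β u M X ⟩
    M * u * (1ℚ - β + β * (M + ⟦ 2 ⟧ * X) * u) ∎
    where
    open ≡-Reasoning
    X M : ℚ
    X = ⟦ a ⟧
    M = ⟦ m ⟧

  oneBetaProcess-deviation : ∀ i → p i - u ≡ β * u * (⟦ 2 ℕ.* i ∸ 1 ⟧ * u - 1ℚ)
  oneBetaProcess-deviation i = begin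
    p i - u
      ≡⟨ cong (_- u) (oneBetaProcess-affine i) ⟩
    (1ℚ - β) * u + β * u * u * ⟦ A ⟧ - u
      ≡⟨ solve 3 (λ β u A → (con 1ℚ :- β) :* u :+ β :* u :* u :* A :- u
                          := β :* u :* (A :* u :- con 1ℚ)) refl β u ⟦ A ⟧ ⟩
    β * u * (⟦ A ⟧ * u - 1ℚ)
      ∎
    where
    open ≡-Reasoning
    A : ℕ
    A = 2 ℕ.* i ∸ 1

  oneBetaProcess-C₃ : .{{NonNegative β}} → C₃ n p (1ℚ + β)
  oneBetaProcess-C₃ i _ i≤n = begin
    ∣ p i - u ∣                  ≡⟨ cong ∣_∣ (oneBetaProcess-deviation i) ⟩
    ∣ β * u * (x - 1ℚ) ∣         ≡⟨ ∣p*q∣≡∣p∣*∣q∣ (β * u) (x - 1ℚ) ⟩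
    ∣ β * u ∣ * ∣ x - 1ℚ ∣
      ≡⟨ cong (_* ∣ x - 1ℚ ∣) (0≤p⇒∣p∣≡p (nonNegative⁻¹ (β * u))) ⟩
    β * u * ∣ x - 1ℚ ∣           ≤⟨ *-monoˡ-≤-nonNeg (β * u) (-q≤p≤q⇒∣p∣≤q -1≤x-1 x-1≤1) ⟩
    β * u * 1ℚ
      ≡⟨ solve 2 (λ β u → β :* u :* con 1ℚ := (con 1ℚ :+ β :- con 1ℚ) :* u) refl β u ⟩
    (1ℚ + β - 1ℚ) * u            ∎
    where
    open ≤-Reasoning
    A : ℕ
    A = 2 ℕ.* i ∸ 1
    x : ℚ
    x = ⟦ A ⟧ * u
    instance
      βu-nonNeg : NonNegative (β * u)
      βu-nonNeg = nonNeg*nonNeg⇒nonNeg β u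
      x-nonNeg : NonNegative x
      x-nonNeg = nonNeg*nonNeg⇒nonNeg ⟦ A ⟧ {{⟦⟧-nonNeg A}} u
    A≤2n : A ℕ.≤ 2 ℕ.* n
    A≤2n = ℕP.≤-trans (ℕP.m∸n≤m (2 ℕ.* i) 1) (ℕP.*-monoʳ-≤ 2 i≤n)
    x≤2 : x ≤ ⟦ 2 ⟧
    x≤2 = begin
      ⟦ A ⟧ * u              ≤⟨ *-monoʳ-≤-nonNeg u (⟦⟧-mono-≤ {A} {2 ℕ.* n} A≤2n) ⟩
      ⟦ 2 ℕ.* n ⟧ * u        ≡⟨ cong (_* u) (⟦⟧-homo-* 2 n) ⟩
      ⟦ 2 ⟧ * N * u          ≡⟨ q*⟦n⟧*1/n≡q ⟦ 2 ⟧ n ⟩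
      ⟦ 2 ⟧                  ∎
    -1≤x-1 : - 1ℚ ≤ x - 1ℚ
    -1≤x-1 = +-monoˡ-≤ (- 1ℚ) (nonNegative⁻¹ x)
    x-1≤1 : x - 1ℚ ≤ 1ℚ
    x-1≤1 = +-monoˡ-≤ (- 1ℚ) x≤2

  oneBetaProcess-prefix : ∀ k → sumFromLen p 1 k ≡ ⟦ k ⟧ * u * (1ℚ - β + β * (⟦ k ⟧ * u))
  oneBetaProcess-prefix k = trans (oneBetaProcess-window 0 k)
    (solve 3 (λ β u K → K :* u :* (con 1ℚ :- β :+ β :* (K :+ con ⟦ 2 ⟧ :* con 0ℚ) :* u)
                      := K :* u :* (con 1ℚ :- β :+ β :* (K :* u))) refl β u ⟦ k ⟧)

  oneBetaProcess-suffix : ∀ a → a ℕ.≤ n →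
    sumFromLen p (suc a) (n ∸ a) ≡ ⟦ n ∸ a ⟧ * u * (1ℚ + β * (⟦ a ⟧ * u))
  oneBetaProcess-suffix a a≤n = begin
    sumFromLen p (suc a) m                       ≡⟨ oneBetaProcess-window a m ⟩
    M * u * (1ℚ - β + β * (M + ⟦ 2 ⟧ * X) * u)
      ≡⟨ solve 4 (λ β u M X → M :* u :* (con 1ℚ :- β :+ β :* (M :+ con ⟦ 2 ⟧ :* X) :* u)
                            := M :* u :* (con 1ℚ :- β :+ β :* (M :* u :+ X :* u :+ X :* u))) refl β u M X ⟩
    M * u * (1ℚ - β + β * (M * u + X * u + X * u))
      ≡⟨ cong (λ t → M * u * (1ℚ - β + β * (t + X * u))) Mu+Xu≡1 ⟩
    M * u * (1ℚ - β + β * (1ℚ + X * u))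
      ≡⟨ solve 4 (λ β u M X → M :* u :* (con 1ℚ :- β :+ β :* (con 1ℚ :+ X :* u))
                            := M :* u :* (con 1ℚ :+ β :* (X :* u))) refl β u M X ⟩
    M * u * (1ℚ + β * (X * u))                   ∎
    where
    open ≡-Reasoning
    m : ℕ
    m = n ∸ a
    M X : ℚ
    M = ⟦ m ⟧
    X = ⟦ a ⟧
    Mu+Xu≡1 : M * u + X * u ≡ 1ℚ
    Mu+Xu≡1 = begin
      M * u + X * u   ≡⟨ *-distribʳ-+ u M X ⟨
      (M + X) * u     ≡⟨ cong (_* u) (⟦⟧-homo-+ m a) ⟨
      ⟦ m ℕ.+ a ⟧ * u ≡⟨ cong (λ j → ⟦ j ⟧ * u) (ℕP.m∸n+n≡m a≤n) ⟩
      N * u           ≡⟨ ⟦n⟧*1/n≡1 n ⟩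
      1ℚ              ∎

  oneBetaProcess-head : .{{NonNegative β}} → ∀ k → ⟦ k ⟧ ≤ ¼ * N →
    Σ[ 1 ⋯ k ] p ≤ (1ℚ - β * ½) * (+ k / n)
  oneBetaProcess-head k k≤¼N = begin
    sumFromLen p 1 k               ≡⟨ oneBetaProcess-prefix k ⟩
    x * (1ℚ - β + β * x)
      ≤⟨ *-monoˡ-≤-nonNeg x {{x-nonNeg}} (+-monoʳ-≤ (1ℚ - β) (*-monoˡ-≤-nonNeg β x≤½)) ⟩
    x * (1ℚ - β + β * ½)
      ≡⟨ solve 2 (λ β x → x :* (con 1ℚ :- β :+ β :* con ½) := (con 1ℚ :- β :* con ½) :* x) refl β x ⟩
    (1ℚ - β * ½) * x               ≡⟨ cong ((1ℚ - β * ½) *_) (a/d≡⟦a⟧*1/d k n) ⟨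
    (1ℚ - β * ½) * (+ k / n)       ∎
    where
    open ≤-Reasoning
    x : ℚ
    x = ⟦ k ⟧ * u
    x-nonNeg : NonNegative x
    x-nonNeg = nonNeg*nonNeg⇒nonNeg ⟦ k ⟧ {{⟦⟧-nonNeg k}} u
    x≤½ : x ≤ ½
    x≤½ = begin
      x           ≤⟨ *-monoʳ-≤-nonNeg u k≤¼N ⟩
      ¼ * N * u   ≡⟨ q*⟦n⟧*1/n≡q ¼ n ⟩
      ¼           ≤⟨ ≤ᵇ⇒≤ tt ⟩
      ½           ∎

  oneBetaProcess-tail : .{{NonNegative β}} → ∀ k → ¼ * N + 1ℚ ≤ ⟦ k ⟧ → k ℕ.≤ n →
    (1ℚ + β * ½ * (¼ ÷ (1ℚ - ¼))) * (+ (n ∸ k ℕ.+ 1) / n) ≤ Σ[ k ⋯ n ] p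
  oneBetaProcess-tail zero ¼N+1≤0 _ = contradiction (<-≤-trans (positive⁻¹ 1ℚ) 1≤0) (<-irrefl refl)
    where
    1≤0 : 1ℚ ≤ 0ℚ
    1≤0 = ≤-trans (+-monoˡ-≤ 1ℚ 0≤¼N) ¼N+1≤0
      where
      0≤¼N : 0ℚ ≤ ¼ * N
      0≤¼N = nonNegative⁻¹ (¼ * N) {{nonNeg*nonNeg⇒nonNeg ¼ N {{⟦⟧-nonNeg n}}}}
  oneBetaProcess-tail (suc a) ¼N+1≤1+a a<n = begin
    (1ℚ + β * ½ * (¼ ÷ (1ℚ - ¼))) * (+ (n ∸ suc a ℕ.+ 1) / n)
      ≡⟨ cong ((1ℚ + β * ½ * (¼ ÷ (1ℚ - ¼))) *_) y≡suffix-fraction ⟩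
    (1ℚ + β * ½ * (¼ ÷ (1ℚ - ¼))) * y
      ≡⟨ solve 2 (λ β y → (con 1ℚ :+ β :* con ½ :* con (¼ ÷ (1ℚ - ¼))) :* y
                          := y :* (con 1ℚ :+ β :* con (+ 1 / 6))) refl β y ⟩
    y * (1ℚ + β * (+ 1 / 6))
      ≤⟨ *-monoˡ-≤-nonNeg y {{y-nonNeg}} (+-monoʳ-≤ 1ℚ (*-monoˡ-≤-nonNeg β 1/6≤z)) ⟩
    y * (1ℚ + β * z)               ≡⟨ oneBetaProcess-suffix a (ℕP.<⇒≤ a<n) ⟨
    sumFromLen p (suc a) m         ∎
    where
    open ≤-Reasoning
    m : ℕ
    m = n ∸ a
    y z : ℚ
    y = ⟦ m ⟧ * u
    z = ⟦ a ⟧ * u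
    y-nonNeg : NonNegative y
    y-nonNeg = nonNeg*nonNeg⇒nonNeg ⟦ m ⟧ {{⟦⟧-nonNeg m}} u
    y≡suffix-fraction : + (n ∸ suc a ℕ.+ 1) / n ≡ y
    y≡suffix-fraction = trans (cong (λ j → + j / n) suffix-length) (a/d≡⟦a⟧*1/d m n)
      where
      suffix-length : n ∸ suc a ℕ.+ 1 ≡ m
      suffix-length = trans (ℕP.+-comm (n ∸ suc a) 1) (sym (ℕP.+-∸-assoc 1 a<n))
    ¼N≤a : ¼ * N ≤ ⟦ a ⟧
    ¼N≤a = +-cancelʳ-≤ 1ℚ (subst (¼ * N + 1ℚ ≤_) (trans (⟦⟧-homo-+ 1 a) (+-comm 1ℚ ⟦ a ⟧)) ¼N+1≤1+a)
    1/6≤z : + 1 / 6 ≤ z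
    1/6≤z = begin
      + 1 / 6         ≤⟨ ≤ᵇ⇒≤ tt ⟩
      ¼               ≡⟨ q*⟦n⟧*1/n≡q ¼ n ⟨
      ¼ * N * u       ≤⟨ *-monoʳ-≤-nonNeg u ¼N≤a ⟩
      z               ∎

-- β ≤ 1 only serves to make p a probability vector; none of the three bounds needs it.
lemma2p1 : ∀ (β : ℚ) → 0ℚ < β → β ≤ 1ℚ → ∀ (n : ℕ) .{{_ : ℕ.NonZero n}} →
    C₁ n (oneBetaProcess β n) (+ 1 / 4) (β * ½)
      × C₂ n (oneBetaProcess β n) (1ℚ + β)
      × C₃ n (oneBetaProcess β n) (1ℚ + β)
lemma2p1 β 0<β _ n =
  ((λ k _ → oneBetaProcess-head β n k) , oneBetaProcess-tail β n) ,
  C₃⇒C₂ n (oneBetaProcess β n) (1ℚ + β) c₃ , c₃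
  where
  instance
    β-nonNeg : NonNegative β
    β-nonNeg = nonNegative (<⇒≤ 0<β)
  c₃ : C₃ n (oneBetaProcess β n) (1ℚ + β)
  c₃ = oneBetaProcess-C₃ β n
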